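{- For all sufficiently large $n$ the following holds. If $X$ is a set of $n$ integers contained in $\{1, \dots, M\}$, where $M = 4n^4 6^{n/2}$, then there exists a subset $X' \subseteq X$ with $|X'| \geqslant |X|/2$ that can be compressed into a subset of the segment $\{1, \dots, n^3\}$.
   Context: For a set of integers $X=\{x_1,\dots,x_m\}$ (distinct elements), a set $Y=\{y_1,\dots,y_m\}$ (distinct elements) is called a compression of $X$ if for all triples $(i,j,k)\in\{1,\dots,m\}^3$, the equality $x_i - 2x_j + x_k = 0$ implies $y_i - 2y_j + y_k = 0$. "$X$ can be compressed into a subset of $S$" means there exists a compression $Y$ of $X$ with $Y\subseteq S$. -}

module Defs where

open import Data.Nat as ℕ using (ℕ)
open import Data.Integer using (ℤ; +_; _+_; _-_; _*_; _≤_)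
open import Data.Fin using (Fin)
open import Relation.Binary.PropositionalEquality using (_≡_)
open import Function.Definitions using (Injective)
open import Data.Product using (_×_)

-- A finite set of integers {x_1,…,x_m} with distinct elements,
-- given as an injective enumeration.
Distinct : {m : ℕ} → (Fin m → ℤ) → Set
Distinct x = Injective _≡_ _≡_ x

IsCompression : {m : ℕ} → (Fin m → ℤ) → (Fin m → ℤ) → Set
IsCompression {m} x y =
  Distinct y ×
  ((i j k : Fin m) → x i - (+ 2) * x j + x k ≡ + 0 → y i - (+ 2) * y j + y k ≡ + 0)

-- z ∈ {1, …, M} with M = 4 n^4 6^(n/2) (a real number in general).
-- For z ≥ 1, z ≤ 4 n^4 6^(n/2)  ⇔  z² ≤ 16 n^8 6^n.
InRangeM : ℕ → ℤ → Set
InRangeM n z = (+ 1 ≤ z) × (z * z ≤ + (16 ℕ.* (n ℕ.^ 8) ℕ.* (6 ℕ.^ n)))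

InSegment : ℕ → ℤ → Set
InSegment n z = (+ 1 ≤ z) × (z ≤ + (n ℕ.^ 3))

-- Reduce modulo a small p. If p divides no nonzero difference x_i − x_j, the residues of
-- the x_i are distinct, and on the points whose residues (after a rotation) lie in a window
-- of length about p/2, which is at least half of them, every relation x_i + x_k = 2 x_j
-- survives as an exact equality of residues, since sums of two residues cannot wrap around.
-- Such a p ≤ 2n³ exists: otherwise lcm(1,…,2n³) would divide the product D of the nonzero
-- differences, but lcm(1,…,2m) ≥ m·C(2m,m) ≥ 4^m/2 while D ≤ M^(n²), and
-- 16^(n³) > 4 M^(2n²) for n ≥ 40.

module Submission where

open import Defs
open import Data.Nat using (ℕ; _≥_; _*_)
open import Data.Integer using (ℤ)
open import Data.Fin using (Fin)
open import Data.Product using (Σ; _×_; ∃-syntax)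
open import Function.Definitions using (Injective)
open import Relation.Binary.PropositionalEquality using (_≡_)

open import Data.Nat
open import Data.Nat.Properties
open import Data.Nat.Combinatorics using (_C_; nC1≡n; nCk+nC[k+1]≡[n+1]C[k+1]; nCk≡nC[n∸k])
open import Data.Nat.Divisibility
open import Data.Nat.DivMod
open import Data.Nat.LCM using (lcm; m∣lcm[m,n]; n∣lcm[m,n]; lcm-least)
open import Data.Nat.Tactic.RingSolver using (solve-∀; solve)
import Data.Integer as ℤ
import Data.Integer.Properties as ℤ
import Data.Integer.Tactic.RingSolver as ℤ
open import Data.Fin using (zero; suc)
import Data.Fin.Properties as Finₚ
open import Data.Vec.Functional using (foldr)
open import Data.List using (_∷_; [])
open import Data.Product using (_,_; proj₁; proj₂)
open import Data.Sum using (_⊎_; inj₁; inj₂)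
open import Function using (_∘_)
open import Level using (0ℓ)
open import Relation.Nullary using (¬_; yes; no; ¬?; contradiction)
open import Relation.Nullary.Decidable using (decidable-stable)
open import Relation.Unary using (Pred; Decidable; ∁)
open import Relation.Binary.PropositionalEquality
open import Algebra.Properties.CommutativeSemigroup *-commutativeSemigroup using (x∙yz≈y∙xz)
  renaming (interchange to *-interchange)
open import Algebra.Properties.CommutativeSemigroup +-commutativeSemigroup using ()
  renaming (x∙yz≈y∙xz to x+[y+z]≡y+[x+z]; interchange to +-interchange)

^-distribʳ-* : ∀ a b n → (a * b) ^ n ≡ a ^ n * b ^ n
^-distribʳ-* a b zero    = refl
^-distribʳ-* a b (suc n) =
  trans (cong (a * b *_) (^-distribʳ-* a b n)) (*-interchange a b (a ^ n) (b ^ n))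

nCk>0 : ∀ {n k} → k ≤ n → n C k > 0
nCk>0 {n}     {zero}  _         = z<s
nCk>0 {suc n} {suc k} (s≤s k≤n) =
  subst (_> 0) (nCk+nC[k+1]≡[n+1]C[k+1] n k) (<-≤-trans (nCk>0 k≤n) (m≤m+n _ _))

[k+1]*[n+1]C[k+1]≡[n+1]*nCk : ∀ n k → suc k * (suc n C suc k) ≡ suc n * (n C k)
[k+1]*[n+1]C[k+1]≡[n+1]*nCk n       zero    =
  trans (*-identityˡ _) (trans (nC1≡n (suc n)) (sym (*-identityʳ (suc n))))
[k+1]*[n+1]C[k+1]≡[n+1]*nCk zero    (suc k) = *-zeroʳ (suc (suc k))
[k+1]*[n+1]C[k+1]≡[n+1]*nCk (suc n) (suc k) = begin
  suc (suc k) * (suc (suc n) C suc (suc k))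
    ≡⟨ cong (suc (suc k) *_) (nCk+nC[k+1]≡[n+1]C[k+1] (suc n) (suc k)) ⟨
  suc (suc k) * (u + v)
    ≡⟨ split-factor u v k ⟩
  suc k * u + u + suc (suc k) * v
    ≡⟨ cong₂ (λ a b → a + u + b) ([k+1]*[n+1]C[k+1]≡[n+1]*nCk n k)
                                  ([k+1]*[n+1]C[k+1]≡[n+1]*nCk n (suc k)) ⟩
  suc n * (n C k) + u + suc n * (n C suc k)
    ≡⟨ cong (λ a → suc n * (n C k) + a + suc n * (n C suc k)) (nCk+nC[k+1]≡[n+1]C[k+1] n k) ⟨
  suc n * (n C k) + (n C k + n C suc k) + suc n * (n C suc k)
    ≡⟨ merge-factor n (n C k) (n C suc k) ⟩
  suc (suc n) * (n C k + n C suc k)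
    ≡⟨ cong (suc (suc n) *_) (nCk+nC[k+1]≡[n+1]C[k+1] n k) ⟩
  suc (suc n) * (suc n C suc k) ∎
  where
  open ≡-Reasoning
  u v : ℕ
  u = suc n C suc k
  v = suc n C suc (suc k)
  split-factor : ∀ a b k → suc (suc k) * (a + b) ≡ suc k * a + a + suc (suc k) * b
  split-factor = solve-∀
  merge-factor : ∀ n a b → suc n * a + (a + b) + suc n * b ≡ suc (suc n) * (a + b)
  merge-factor = solve-∀

lcmUpTo : ℕ → ℕ
lcmUpTo zero    = 1
lcmUpTo (suc n) = lcm (lcmUpTo n) (suc n)

n∣lcmUpTo[n] : ∀ n → suc n ∣ lcmUpTo (suc n)
n∣lcmUpTo[n] n = n∣lcm[m,n] (lcmUpTo n) (suc n)

lcmUpTo-least : ∀ {n d} → (∀ {q} → q < n → suc q ∣ d) → lcmUpTo n ∣ d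
lcmUpTo-least {zero}  _   = 1∣ _
lcmUpTo-least {suc n} ∣d = lcm-least (lcmUpTo-least (∣d ∘ m<n⇒m<1+n)) (∣d ≤-refl)

-- b c = b a + a c says 1/b = 1/a − 1/c, so that m/b = m/a − m/c.
harmonic-∣ : ∀ {a b c m} .{{_ : NonZero a}} .{{_ : NonZero c}} →
             b * c ≡ b * a + a * c → a ∣ m → c ∣ m → b ∣ m
harmonic-∣ {a} {b} {c} {m} eq (divides α m≡αa) (divides γ m≡γc) =
  ∣m+n∣m⇒∣n (subst (b ∣_) αb≡γb+m (n∣m*n α)) (n∣m*n γ)
  where
  open ≡-Reasoning
  instance
    _ : NonZero (a * c)
    _ = m*n≢0 a c
  αb≡γb+m : α * b ≡ γ * b + m
  αb≡γb+m = *-cancelʳ-≡ (α * b) (γ * b + m) (a * c) (begin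
    α * b * (a * c)       ≡⟨ solve (α ∷ b ∷ a ∷ c ∷ []) ⟩
    b * c * (α * a)       ≡⟨ cong (b * c *_) m≡αa ⟨
    b * c * m             ≡⟨ cong (_* m) eq ⟩
    (b * a + a * c) * m   ≡⟨ *-distribʳ-+ m (b * a) (a * c) ⟩
    b * a * m + a * c * m ≡⟨ cong (λ z → b * a * z + a * c * m) m≡γc ⟩
    b * a * (γ * c) + a * c * m ≡⟨ solve (b ∷ a ∷ γ ∷ c ∷ m ∷ []) ⟩
    (γ * b + m) * (a * c) ∎)

[k+1]*nC[k+1]∣lcmUpTo[n] : ∀ {n k} → k < n → suc k * (n C suc k) ∣ lcmUpTo n
[k+1]*nC[k+1]∣lcmUpTo[n] {suc n} {zero}  _ =
  subst (_∣ lcmUpTo (suc n)) (sym (trans (+-identityʳ _) (nC1≡n (suc n)))) (n∣lcmUpTo[n] n)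
[k+1]*nC[k+1]∣lcmUpTo[n] {suc n} {suc k} (s≤s k<n) =
  harmonic-∣ {{a≢0}} {{c≢0}} bc≡ba+ac
    (∣-trans ([k+1]*nC[k+1]∣lcmUpTo[n] k<n) (m∣lcm[m,n] (lcmUpTo n) (suc n)))
    ([k+1]*nC[k+1]∣lcmUpTo[n] (m<n⇒m<1+n k<n))
  where
  open ≡-Reasoning
  u v a b c : ℕ
  u = n C suc k
  v = n C k
  a = suc k * u
  b = suc (suc k) * (suc n C suc (suc k))
  c = suc k * (suc n C suc k)
  a≢0 : NonZero a
  a≢0 = m*n≢0 (suc k) u {{_}} {{>-nonZero (nCk>0 k<n)}}
  c≢0 : NonZero c
  c≢0 = m*n≢0 (suc k) (suc n C suc k) {{_}} {{>-nonZero (nCk>0 (m<n⇒m<1+n k<n))}}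
  bc≡ba+ac : b * c ≡ b * a + a * c
  bc≡ba+ac = begin
    b * c
      ≡⟨ cong₂ _*_ ([k+1]*[n+1]C[k+1]≡[n+1]*nCk n (suc k))
                   (cong (suc k *_) (sym (nCk+nC[k+1]≡[n+1]C[k+1] n k))) ⟩
    (suc n * u) * (suc k * (v + u))
      ≡⟨ expand n u k v ⟩
    (suc n * u) * (suc k * u) + (suc k * u) * (suc n * v)
      ≡⟨ cong₂ (λ x y → x * a + a * y) ([k+1]*[n+1]C[k+1]≡[n+1]*nCk n (suc k))
                                        ([k+1]*[n+1]C[k+1]≡[n+1]*nCk n k) ⟨
    b * a + a * c ∎
    where
    expand : ∀ n u k v →
             suc n * u * (suc k * (v + u)) ≡ suc n * u * (suc k * u) + suc k * u * (suc n * v)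
    expand = solve-∀

[m+1]*[2m+2]C[m+1]≡2*[2m+1]*[2m]Cm : ∀ m →
  suc m * ((suc m + suc m) C suc m) ≡ 2 * (suc (m + m) * ((m + m) C m))
[m+1]*[2m+2]C[m+1]≡2*[2m+1]*[2m]Cm m = *-cancelˡ-≡ _ _ (suc m) (begin
  suc m * (suc m * ((suc m + suc m) C suc m))
    ≡⟨ cong (λ n → suc m * (suc m * (n C suc m))) (cong suc (+-suc m m)) ⟩
  suc m * (suc m * (suc (suc (m + m)) C suc m))
    ≡⟨ cong (suc m *_) ([k+1]*[n+1]C[k+1]≡[n+1]*nCk (suc (m + m)) m) ⟩
  suc m * (suc (suc (m + m)) * (suc (m + m) C m))
    ≡⟨ cong (λ x → suc m * (suc (suc (m + m)) * x)) [2m+1]Cm≡[2m+1]C[m+1] ⟩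
  suc m * (suc (suc (m + m)) * (suc (m + m) C suc m))
    ≡⟨ x∙yz≈y∙xz (suc m) (suc (suc (m + m))) (suc (m + m) C suc m) ⟩
  suc (suc (m + m)) * (suc m * (suc (m + m) C suc m))
    ≡⟨ cong (suc (suc (m + m)) *_) ([k+1]*[n+1]C[k+1]≡[n+1]*nCk (m + m) m) ⟩
  suc (suc (m + m)) * (suc (m + m) * ((m + m) C m))
    ≡⟨ regroup m (suc (m + m) * ((m + m) C m)) ⟩
  suc m * (2 * (suc (m + m) * ((m + m) C m))) ∎)
  where
  open ≡-Reasoning
  [2m+1]Cm≡[2m+1]C[m+1] : suc (m + m) C m ≡ suc (m + m) C suc m
  [2m+1]Cm≡[2m+1]C[m+1] = trans (nCk≡nC[n∸k] (≤-trans (m≤m+n m m) (n≤1+n _)))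
    (cong (suc (m + m) C_) (trans (+-∸-assoc 1 (m≤n+m m m)) (cong suc (m+n∸n≡m m m))))
  regroup : ∀ m x → suc (suc (m + m)) * x ≡ suc m * (2 * x)
  regroup = solve-∀

4^[m+1]≤2*[m+1]*[2m+2]C[m+1] : ∀ m → 4 ^ suc m ≤ 2 * (suc m * ((suc m + suc m) C suc m))
4^[m+1]≤2*[m+1]*[2m+2]C[m+1] zero    = ≤-refl
4^[m+1]≤2*[m+1]*[2m+2]C[m+1] (suc m) = begin
  4 * 4 ^ suc m                  ≤⟨ *-monoʳ-≤ 4 (4^[m+1]≤2*[m+1]*[2m+2]C[m+1] m) ⟩
  4 * (2 * (suc m * c))          ≤⟨ m≤m+n _ (4 * c) ⟩
  4 * (2 * (suc m * c)) + 4 * c  ≡⟨ regroup m c ⟩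
  2 * (2 * (suc (suc m + suc m) * c))
    ≡⟨ cong (2 *_) ([m+1]*[2m+2]C[m+1]≡2*[2m+1]*[2m]Cm (suc m)) ⟨
  2 * (suc (suc m) * ((suc (suc m) + suc (suc m)) C suc (suc m))) ∎
  where
  open ≤-Reasoning
  c : ℕ
  c = (suc m + suc m) C suc m
  regroup : ∀ m c → 4 * (2 * (suc m * c)) + 4 * c ≡ 2 * (2 * (suc (suc m + suc m) * c))
  regroup = solve-∀

∃-non-divisor : ∀ t {d} .{{_ : NonZero t}} .{{_ : NonZero d}} →
                4 * (d * d) < 16 ^ t → ∃[ q ] q < t + t × ¬ (suc q ∣ d)
∃-non-divisor t@(suc m) {d} 4d²<16^t with anyUpTo? (λ q → ¬? (suc q ∣? d)) (t + t)
... | yes non-divisor = non-divisor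
... | no  none        = contradiction 4d²<16^t (≤⇒≯ 16^t≤4d²)
  where
  open ≤-Reasoning
  all-divide : ∀ {q} → q < t + t → suc q ∣ d
  all-divide {q} q<2t = decidable-stable (suc q ∣? d) (λ q∤d → none (q , q<2t , q∤d))
  4^t≤2d : 4 ^ t ≤ 2 * d
  4^t≤2d = ≤-trans (4^[m+1]≤2*[m+1]*[2m+2]C[m+1] m) (*-monoʳ-≤ 2 (∣⇒≤ (∣-trans
    ([k+1]*nC[k+1]∣lcmUpTo[n] (m≤m+n t t)) (lcmUpTo-least all-divide))))
  16^t≤4d² : 16 ^ t ≤ 4 * (d * d)
  16^t≤4d² = begin
    16 ^ t              ≡⟨ ^-distribʳ-* 4 4 t ⟩
    4 ^ t * 4 ^ t       ≤⟨ *-mono-≤ 4^t≤2d 4^t≤2d ⟩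
    2 * d * (2 * d)     ≡⟨ solve (d ∷ []) ⟩
    4 * (d * d) ∎

bound : ℕ → ℕ
bound n = 16 * n ^ 8 * 6 ^ n

bound≢0 : ∀ n .{{_ : NonZero n}} → NonZero (bound n)
bound≢0 n = m*n≢0 (16 * n ^ 8) (6 ^ n) {{m*n≢0 16 (n ^ 8) {{_}} {{m^n≢0 n 8}}}} {{m^n≢0 6 n}}

[n+1]^8≤2*n^8 : ∀ {n} → 12 ≤ n → suc n ^ 8 ≤ 2 * n ^ 8
[n+1]^8≤2*n^8 {n} 12≤n = *-cancelˡ-≤ (12 ^ 8) (begin
  12 ^ 8 * suc n ^ 8  ≡⟨ ^-distribʳ-* 12 (suc n) 8 ⟨
  (12 * suc n) ^ 8    ≤⟨ ^-monoˡ-≤ 8 12[n+1]≤13n ⟩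
  (13 * n) ^ 8        ≡⟨ ^-distribʳ-* 13 n 8 ⟩
  13 ^ 8 * n ^ 8      ≤⟨ *-monoˡ-≤ (n ^ 8) (≤ᵇ⇒≤ (13 ^ 8) (12 ^ 8 * 2) _) ⟩
  12 ^ 8 * 2 * n ^ 8  ≡⟨ *-assoc (12 ^ 8) 2 (n ^ 8) ⟩
  12 ^ 8 * (2 * n ^ 8) ∎)
  where
  open ≤-Reasoning
  12[n+1]≤13n : 12 * suc n ≤ 13 * n
  12[n+1]≤13n = subst (_≤ 13 * n) (sym (*-suc 12 n)) (+-monoˡ-≤ (12 * n) 12≤n)

128*bound[n]≤16^n : ∀ {n} → 40 ≤ n → 128 * bound n ≤ 16 ^ n
128*bound[n]≤16^n 40≤n = go (≤⇒≤′ 40≤n)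
  where
  go : ∀ {n} → 40 ≤′ n → 128 * bound n ≤ 16 ^ n
  go ≤′-refl = ≤ᵇ⇒≤ (128 * bound 40) (16 ^ 40) _
  go (≤′-step {n} 40≤′n) = begin
    128 * (16 * suc n ^ 8 * (6 * 6 ^ n))
      ≤⟨ *-monoʳ-≤ 128 (*-monoˡ-≤ (6 * 6 ^ n) (*-monoʳ-≤ 16 ([n+1]^8≤2*n^8 12≤n))) ⟩
    128 * (16 * (2 * n ^ 8) * (6 * 6 ^ n)) ≡⟨ regroup (n ^ 8) (6 ^ n) ⟩
    12 * (128 * bound n)                   ≤⟨ *-mono-≤ (≤ᵇ⇒≤ 12 16 _) (go 40≤′n) ⟩
    16 * 16 ^ n ∎
    where
    open ≤-Reasoning
    12≤n : 12 ≤ n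
    12≤n = ≤-trans (≤ᵇ⇒≤ 12 40 _) (≤′⇒≤ 40≤′n)
    regroup : ∀ a b → 128 * (16 * (2 * a) * (6 * b)) ≡ 12 * (128 * (16 * a * b))
    regroup = solve-∀

4*bound[n]^[n*n]<16^[n^3] : ∀ {n} → 40 ≤ n → 4 * bound n ^ (n * n) < 16 ^ (n ^ 3)
4*bound[n]^[n*n]<16^[n^3] {n} 40≤n = begin-strict
  4 * bound n ^ (n * n)            <⟨ *-monoˡ-< (bound n ^ (n * n)) (≤ᵇ⇒≤ 5 128 _) ⟩
  128 * bound n ^ (n * n)          ≤⟨ *-monoˡ-≤ (bound n ^ (n * n)) 128≤128^[n*n] ⟩
  128 ^ (n * n) * bound n ^ (n * n) ≡⟨ ^-distribʳ-* 128 (bound n) (n * n) ⟨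
  (128 * bound n) ^ (n * n)        ≤⟨ ^-monoˡ-≤ (n * n) (128*bound[n]≤16^n 40≤n) ⟩
  (16 ^ n) ^ (n * n)               ≡⟨ ^-*-assoc 16 n (n * n) ⟩
  16 ^ (n * (n * n))               ≡⟨ cong (λ k → 16 ^ (n * (n * k))) (*-identityʳ n) ⟨
  16 ^ (n ^ 3) ∎
  where
  open ≤-Reasoning
  instance
    _ : NonZero n
    _ = >-nonZero (≤-trans (≤ᵇ⇒≤ 1 40 _) 40≤n)
    _ : NonZero (bound n ^ (n * n))
    _ = m^n≢0 (bound n) (n * n) {{bound≢0 n}}
  128≤128^[n*n] : 128 ≤ 128 ^ (n * n)
  128≤128^[n*n] = subst (_≤ 128 ^ (n * n)) (*-identityʳ 128)
    (^-monoʳ-≤ 128 (>-nonZero⁻¹ (n * n) {{m*n≢0 n n}}))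

∏ : ∀ {n} → (Fin n → ℕ) → ℕ
∏ = foldr _*_ 1

∣∏ : ∀ {n} (f : Fin n → ℕ) i → f i ∣ ∏ f
∣∏ f zero    = m∣m*n _
∣∏ f (suc i) = ∣n⇒∣m*n (f zero) (∣∏ (f ∘ suc) i)

∏>0 : ∀ {n} {f : Fin n → ℕ} → (∀ i → f i > 0) → ∏ f > 0
∏>0 {zero}  f>0 = z<s
∏>0 {suc n} f>0 = *-mono-< (f>0 zero) (∏>0 (f>0 ∘ suc))

∏²≤ : ∀ {n} {f : Fin n → ℕ} b → (∀ i → f i * f i ≤ b) → ∏ f * ∏ f ≤ b ^ n
∏²≤ {zero}      b _  = ≤-refl
∏²≤ {suc n} {f} b f²≤b = begin
  f zero * ∏ (f ∘ suc) * (f zero * ∏ (f ∘ suc))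
    ≡⟨ *-interchange (f zero) (∏ (f ∘ suc)) (f zero) (∏ (f ∘ suc)) ⟩
  f zero * f zero * (∏ (f ∘ suc) * ∏ (f ∘ suc))
    ≤⟨ *-mono-≤ (f²≤b zero) (∏²≤ b (f²≤b ∘ suc)) ⟩
  b * b ^ n ∎
  where open ≤-Reasoning

record Selection {n} (P : Pred (Fin n) 0ℓ) : Set where
  field
    size      : ℕ
    index     : Fin size → Fin n
    injective : Injective _≡_ _≡_ index
    satisfies : ∀ a → P (index a)

open Selection

Selection-map : ∀ {n} {P Q : Pred (Fin n) 0ℓ} → (∀ {i} → P i → Q i) → Selection P → Selection Q
Selection-map P⇒Q S = record
  { size = size S ; index = index S ; injective = injective S ; satisfies = P⇒Q ∘ satisfies S }

∅-selection : ∀ {P : Pred (Fin 0) 0ℓ} → Selection P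
∅-selection = record { size = 0 ; index = λ () ; injective = λ {} ; satisfies = λ () }

skip : ∀ {n} {P : Pred (Fin (suc n)) 0ℓ} → Selection (P ∘ suc) → Selection P
skip S = record
  { size      = size S
  ; index     = suc ∘ index S
  ; injective = injective S ∘ Finₚ.suc-injective
  ; satisfies = satisfies S
  }

take : ∀ {n} {P : Pred (Fin (suc n)) 0ℓ} → P zero → Selection (P ∘ suc) → Selection P
take {n} {P} p S = record
  { size      = suc (size S)
  ; index     = index′
  ; injective = injective′
  ; satisfies = satisfies′
  }
  where
  index′ : Fin (suc (size S)) → Fin (suc n)
  index′ zero    = zero
  index′ (suc a) = suc (index S a)
  injective′ : Injective _≡_ _≡_ index′
  injective′ {zero}  {zero}  _  = refl
  injective′ {suc a} {suc b} eq = cong suc (injective S (Finₚ.suc-injective eq))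
  satisfies′ : ∀ a → P (index′ a)
  satisfies′ zero    = p
  satisfies′ (suc a) = satisfies S a

partition : ∀ {n} {P : Pred (Fin n) 0ℓ} → Decidable P →
            Σ (Selection P) λ S → Σ (Selection (∁ P)) λ S′ → size S + size S′ ≡ n
partition {zero}  P? = ∅-selection , ∅-selection , refl
partition {suc n} P? with partition (P? ∘ suc) | P? zero
... | S , S′ , eq | yes p = take p S , skip S′ , cong suc eq
... | S , S′ , eq | no ¬p = skip S , take ¬p S′ , trans (+-suc (size S) (size S′)) (cong suc eq)

m+n≡o⇒n≤m⇒o≤2*m : ∀ {m n o} → m + n ≡ o → n ≤ m → o ≤ 2 * m
m+n≡o⇒n≤m⇒o≤2*m {m} m+n≡o n≤m =
  subst₂ _≤_ m+n≡o (cong (m +_) (sym (+-identityʳ m))) (+-monoʳ-≤ m n≤m)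

majority : ∀ {n} {P : Pred (Fin n) 0ℓ} → Decidable P →
           Σ (Selection P) (λ S → n ≤ 2 * size S) ⊎ Σ (Selection (∁ P)) (λ S → n ≤ 2 * size S)
majority P? with partition P?
... | S , S′ , eq with ≤-total (size S′) (size S)
...   | inj₁ S′≤S = inj₁ (S , m+n≡o⇒n≤m⇒o≤2*m eq S′≤S)
...   | inj₂ S≤S′ =
  inj₂ (S′ , m+n≡o⇒n≤m⇒o≤2*m (trans (+-comm (size S′) (size S)) eq) S≤S′)

%≡%⇒∣∣-∣ : ∀ m n p .{{_ : NonZero p}} → m % p ≡ n % p → p ∣ ∣ m - n ∣
%≡%⇒∣∣-∣ m n p eq = divides ∣ m / p - n / p ∣ (begin
  ∣ m - n ∣                                    ≡⟨ cong₂ ∣_-_∣ (m≡m%n+[m/n]*n m p) (m≡m%n+[m/n]*n n p) ⟩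
  ∣ m % p + m / p * p - n % p + n / p * p ∣     ≡⟨ cong (λ r → ∣ m % p + m / p * p - r + n / p * p ∣) eq ⟨
  ∣ m % p + m / p * p - m % p + n / p * p ∣     ≡⟨ ∣m+n-m+o∣≡∣n-o∣ (m % p) _ _ ⟩
  ∣ m / p * p - n / p * p ∣                     ≡⟨ *-distribʳ-∣-∣ p (m / p) (n / p) ⟨
  ∣ m / p - n / p ∣ * p ∎)
  where open ≡-Reasoning

%+%-exact : ∀ {m n m′ n′} p .{{_ : NonZero p}} → m + n ≡ m′ + n′ →
            m % p + n % p < p → m′ % p + n′ % p < p → m % p + n % p ≡ m′ % p + n′ % p
%+%-exact {m} {n} {m′} {n′} p eq lt lt′ = begin
  m % p + n % p             ≡⟨ m<n⇒m%n≡m lt ⟨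
  (m % p + n % p) % p       ≡⟨ %-distribˡ-+ m n p ⟨
  (m + n) % p               ≡⟨ cong (_% p) eq ⟩
  (m′ + n′) % p             ≡⟨ %-distribˡ-+ m′ n′ p ⟩
  (m′ % p + n′ % p) % p     ≡⟨ m<n⇒m%n≡m lt′ ⟩
  m′ % p + n′ % p ∎
  where open ≡-Reasoning

+-%-rotate : ∀ {f c} m p .{{_ : NonZero p}} → f + c ≡ p → c ≤ m % p → (f + m) % p ≡ m % p ∸ c
+-%-rotate {f} {c} m p f+c≡p c≤r = begin
  (f + m) % p               ≡⟨ %-distribˡ-+ f m p ⟩
  (f % p + m % p) % p       ≡⟨ cong (λ r → (f % p + r) % p) (m%n%n≡m%n m p) ⟨
  (f % p + m % p % p) % p   ≡⟨ %-distribˡ-+ f (m % p) p ⟨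
  (f + m % p) % p           ≡⟨ cong (λ r → (f + r) % p) (m∸n+n≡m c≤r) ⟨
  (f + (r ∸ c + c)) % p     ≡⟨ cong (_% p) (x+[y+z]≡y+[x+z] f (r ∸ c) c) ⟩
  (r ∸ c + (f + c)) % p     ≡⟨ cong (λ z → (r ∸ c + z) % p) f+c≡p ⟩
  (r ∸ c + p) % p           ≡⟨ [m+n]%n≡m%n (r ∸ c) p ⟩
  (r ∸ c) % p               ≡⟨ m<n⇒m%n≡m (≤-<-trans (m∸n≤m r c) (m%n<n m p)) ⟩
  r ∸ c ∎
  where
  open ≡-Reasoning
  r : ℕ
  r = m % p

⌈n/2⌉+⌈n/2⌉≤1+n : ∀ n → ⌈ n /2⌉ + ⌈ n /2⌉ ≤ suc n
⌈n/2⌉+⌈n/2⌉≤1+n zero          = z≤n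
⌈n/2⌉+⌈n/2⌉≤1+n (suc zero)    = ≤-refl
⌈n/2⌉+⌈n/2⌉≤1+n (suc (suc n)) =
  s≤s (subst (_≤ suc (suc n)) (sym (+-suc ⌈ n /2⌉ ⌈ n /2⌉)) (s≤s (⌈n/2⌉+⌈n/2⌉≤1+n n)))

+-AP-translate : ∀ c {u v w} → u + w ≡ v + v → (c + u) + (c + w) ≡ (c + v) + (c + v)
+-AP-translate c {u} {v} {w} u+w≡v+v = begin
  (c + u) + (c + w)  ≡⟨ +-interchange c u c w ⟩
  (c + c) + (u + w)  ≡⟨ cong ((c + c) +_) u+w≡v+v ⟩
  (c + c) + (v + v)  ≡⟨ +-interchange c c v v ⟩
  (c + v) + (c + v) ∎
  where open ≡-Reasoning

+u-2+v++w≡+[u+w]-+[v+v] : ∀ u v w →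
  ℤ.+ u ℤ.- ℤ.+ 2 ℤ.* ℤ.+ v ℤ.+ ℤ.+ w ≡ ℤ.+ (u + w) ℤ.- ℤ.+ (v + v)
+u-2+v++w≡+[u+w]-+[v+v] u v w = begin
  ℤ.+ u ℤ.- ℤ.+ 2 ℤ.* ℤ.+ v ℤ.+ ℤ.+ w        ≡⟨ regroup (ℤ.+ u) (ℤ.+ v) (ℤ.+ w) ⟩
  (ℤ.+ u ℤ.+ ℤ.+ w) ℤ.- (ℤ.+ v ℤ.+ ℤ.+ v)   ≡⟨ cong₂ ℤ._-_ (ℤ.pos-+ u w) (ℤ.pos-+ v v) ⟨
  ℤ.+ (u + w) ℤ.- ℤ.+ (v + v) ∎
  where
  open ≡-Reasoning
  regroup : ∀ u v w → u ℤ.- ℤ.+ 2 ℤ.* v ℤ.+ w ≡ (u ℤ.+ w) ℤ.- (v ℤ.+ v)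
  regroup = ℤ.solve-∀

AP-ℤ⇒AP-ℕ : ∀ {u v w} → ℤ.+ u ℤ.- ℤ.+ 2 ℤ.* ℤ.+ v ℤ.+ ℤ.+ w ≡ ℤ.+ 0 → u + w ≡ v + v
AP-ℤ⇒AP-ℕ {u} {v} {w} eq = ℤ.+-injective
  (ℤ.i-j≡0⇒i≡j _ _ (trans (sym (+u-2+v++w≡+[u+w]-+[v+v] u v w)) eq))

AP-ℕ⇒AP-ℤ : ∀ {u v w} → u + w ≡ v + v → ℤ.+ u ℤ.- ℤ.+ 2 ℤ.* ℤ.+ v ℤ.+ ℤ.+ w ≡ ℤ.+ 0
AP-ℕ⇒AP-ℤ {u} {v} {w} eq =
  trans (+u-2+v++w≡+[u+w]-+[v+v] u v w) (ℤ.i≡j⇒i-j≡0 (cong ℤ.+_ eq))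

[m⊔n]²≤o : ∀ m n {o} → m * m ≤ o → n * n ≤ o → (m ⊔ n) * (m ⊔ n) ≤ o
[m⊔n]²≤o m n m²≤o n²≤o with ⊔-sel m n
... | inj₁ m⊔n≡m rewrite m⊔n≡m = m²≤o
... | inj₂ m⊔n≡n rewrite m⊔n≡n = n²≤o

HalfCompressibleInto : ∀ {n} → (Fin n → ℤ) → ℕ → Set
HalfCompressibleInto {n} x L =
  ∃[ k ] Σ (Fin k → Fin n) (λ ι → Injective _≡_ _≡_ ι × 2 * k ≥ n ×
    ∃[ y ] (IsCompression (λ a → x (ι a)) y × ((a : Fin k) → ℤ.+ 1 ℤ.≤ y a × y a ℤ.≤ ℤ.+ L)))

module _ {n} (a : Fin n → ℕ) where

  -- The diagonal factors are 1 rather than 0.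
  gap : Fin n → Fin n → ℕ
  gap i j = ∣ a i - a j ∣ ⊔ 1

  gapProduct : ℕ
  gapProduct = ∏ (∏ ∘ gap)

  gapProduct>0 : gapProduct > 0
  gapProduct>0 = ∏>0 (λ i → ∏>0 (λ j → m≤n⊔m ∣ a i - a j ∣ 1))

  ∣a-a∣∣gapProduct : ∀ {i j} → a i ≢ a j → ∣ a i - a j ∣ ∣ gapProduct
  ∣a-a∣∣gapProduct {i} {j} ai≢aj =
    ∣-trans (∣-reflexive ∣ai-aj∣≡gap) (∣-trans (∣∏ (gap i) j) (∣∏ (∏ ∘ gap) i))
    where
    ∣ai-aj∣≡gap : ∣ a i - a j ∣ ≡ gap i j
    ∣ai-aj∣≡gap = sym (m≥n⇒m⊔n≡m (n≢0⇒n>0 (ai≢aj ∘ ∣m-n∣≡0⇒m≡n)))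

  ∤gapProduct⇒separates : ∀ {p} → ¬ (p ∣ gapProduct) →
                          ∀ {i j} → p ∣ ∣ a i - a j ∣ → a i ≡ a j
  ∤gapProduct⇒separates p∤D {i} {j} p∣ with a i ≟ a j
  ... | yes ai≡aj = ai≡aj
  ... | no  ai≢aj = contradiction (∣-trans p∣ (∣a-a∣∣gapProduct ai≢aj)) p∤D

  gapProduct²≤ : ∀ b → 1 ≤ b → (∀ i → a i * a i ≤ b) →
                 gapProduct * gapProduct ≤ b ^ (n * n)
  gapProduct²≤ b 1≤b a²≤b = subst (gapProduct * gapProduct ≤_) (^-*-assoc b n n)
    (∏²≤ (b ^ n) (λ i → ∏²≤ b (λ j → gap²≤b i j)))
    where
    gap²≤b : ∀ i j → gap i j * gap i j ≤ b
    gap²≤b i j = [m⊔n]²≤o ∣ a i - a j ∣ 1 (≤-trans (*-mono-≤ ∣ai-aj∣≤ai⊔aj ∣ai-aj∣≤ai⊔aj)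
                                                    ([m⊔n]²≤o (a i) (a j) (a²≤b i) (a²≤b j))) 1≤b
      where
      ∣ai-aj∣≤ai⊔aj : ∣ a i - a j ∣ ≤ a i ⊔ a j
      ∣ai-aj∣≤ai⊔aj = ∣m-n∣≤m⊔n (a i) (a j)

module _ {n} (x : Fin n → ℤ) (a : Fin n → ℕ) (x≡a : ∀ i → x i ≡ ℤ.+ a i)
         (p : ℕ) .{{_ : NonZero p}} (separates : ∀ i j → p ∣ ∣ a i - a j ∣ → i ≡ j) where

  residue : ℕ → Fin n → ℕ
  residue g i = (g + a i) % p

  x-AP⇒a-AP : ∀ i j k → x i ℤ.- ℤ.+ 2 ℤ.* x j ℤ.+ x k ≡ ℤ.+ 0 → a i + a k ≡ a j + a j
  x-AP⇒a-AP i j k rewrite x≡a i | x≡a j | x≡a k = AP-ℤ⇒AP-ℕ {a i} {a j} {a k}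

  window-compression : ∀ {g w L} → w + w ≤ suc p → w ≤ L →
    (S : Selection (λ i → residue g i < w)) → n ≤ 2 * size S → HalfCompressibleInto x L
  window-compression {g} {w} {L} w+w≤1+p w≤L S n≤2k =
    size S , index S , injective S , n≤2k , y , (y-injective , y-AP) , y-range
    where
    r : Fin (size S) → ℕ
    r b = residue g (index S b)
    y : Fin (size S) → ℤ
    y b = ℤ.+ (1 + r b)
    y-injective : Injective _≡_ _≡_ y
    y-injective {b} {b′} eq = injective S (separates _ _ (subst (p ∣_) (∣m+n-m+o∣≡∣n-o∣ g _ _)
      (%≡%⇒∣∣-∣ _ _ p (suc-injective (ℤ.+-injective eq)))))
    sum<p : ∀ b b′ → r b + r b′ < p
    sum<p b b′ = subst (_≤ p) (+-suc (r b) (r b′))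
      (≤-pred (≤-trans (+-mono-≤ (satisfies S b) (satisfies S b′)) w+w≤1+p))
    y-AP : ∀ b₁ b₂ b₃ → x (index S b₁) ℤ.- ℤ.+ 2 ℤ.* x (index S b₂) ℤ.+ x (index S b₃) ≡ ℤ.+ 0 →
           y b₁ ℤ.- ℤ.+ 2 ℤ.* y b₂ ℤ.+ y b₃ ≡ ℤ.+ 0
    y-AP b₁ b₂ b₃ x-AP = AP-ℕ⇒AP-ℤ {1 + r b₁} {1 + r b₂} {1 + r b₃} (+-AP-translate 1 r-AP)
      where
      r-AP : r b₁ + r b₃ ≡ r b₂ + r b₂
      r-AP = %+%-exact p (+-AP-translate g (x-AP⇒a-AP _ _ _ x-AP)) (sum<p b₁ b₃) (sum<p b₂ b₂)
    y-range : ∀ b → ℤ.+ 1 ℤ.≤ y b × y b ℤ.≤ ℤ.+ L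
    y-range b = ℤ.+≤+ (s≤s z≤n) , ℤ.+≤+ (≤-trans (satisfies S b) w≤L)

  -- Split the residues at ⌈p/2⌉; rotating the upper half by ⌊p/2⌋ brings it below ⌊p/2⌋.
  half-compression : ∀ {L} → ⌈ p /2⌉ ≤ L → HalfCompressibleInto x L
  half-compression {L} ⌈p/2⌉≤L with majority (λ i → residue 0 i <? ⌈ p /2⌉)
  ... | inj₁ (S , n≤2k) = window-compression (⌈n/2⌉+⌈n/2⌉≤1+n p) ⌈p/2⌉≤L S n≤2k
  ... | inj₂ (S , n≤2k) = window-compression ⌊p/2⌋+⌊p/2⌋≤1+p ⌊p/2⌋≤L (Selection-map rotated S) n≤2k
    where
    ⌊p/2⌋≤⌈p/2⌉ : ⌊ p /2⌋ ≤ ⌈ p /2⌉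
    ⌊p/2⌋≤⌈p/2⌉ = ⌊n/2⌋≤⌈n/2⌉ p
    ⌊p/2⌋+⌊p/2⌋≤1+p : ⌊ p /2⌋ + ⌊ p /2⌋ ≤ suc p
    ⌊p/2⌋+⌊p/2⌋≤1+p = ≤-trans (+-mono-≤ ⌊p/2⌋≤⌈p/2⌉ ⌊p/2⌋≤⌈p/2⌉) (⌈n/2⌉+⌈n/2⌉≤1+n p)
    ⌊p/2⌋≤L : ⌊ p /2⌋ ≤ L
    ⌊p/2⌋≤L = ≤-trans ⌊p/2⌋≤⌈p/2⌉ ⌈p/2⌉≤L
    rotated : ∀ {i} → ¬ (residue 0 i < ⌈ p /2⌉) → residue ⌊ p /2⌋ i < ⌊ p /2⌋
    rotated {i} r≮⌈p/2⌉ = begin-strict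
      (⌊ p /2⌋ + a i) % p            ≡⟨ +-%-rotate (a i) p (⌊n/2⌋+⌈n/2⌉≡n p) ⌈p/2⌉≤r ⟩
      a i % p ∸ ⌈ p /2⌉              <⟨ ∸-monoˡ-< r<⌊p/2⌋+⌈p/2⌉ ⌈p/2⌉≤r ⟩
      ⌊ p /2⌋ + ⌈ p /2⌉ ∸ ⌈ p /2⌉    ≡⟨ m+n∸n≡m ⌊ p /2⌋ ⌈ p /2⌉ ⟩
      ⌊ p /2⌋ ∎
      where
      open ≤-Reasoning
      ⌈p/2⌉≤r : ⌈ p /2⌉ ≤ a i % p
      ⌈p/2⌉≤r = ≮⇒≥ r≮⌈p/2⌉
      r<⌊p/2⌋+⌈p/2⌉ : a i % p < ⌊ p /2⌋ + ⌈ p /2⌉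
      r<⌊p/2⌋+⌈p/2⌉ = subst (a i % p <_) (sym (⌊n/2⌋+⌈n/2⌉≡n p)) (m%n<n (a i) p)

half-compression-into-n³ : ∀ {n} → 40 ≤ n → (x : Fin n → ℤ) → Distinct x →
                           (∀ i → InRangeM n (x i)) → HalfCompressibleInto x (n ^ 3)
half-compression-into-n³ {n} 40≤n x x-injective x-range =
  half-compression x a x≡a (suc q) separates ⌈p/2⌉≤n³
  where
  a : Fin n → ℕ
  a i = ℤ.∣ x i ∣
  x≡a : ∀ i → x i ≡ ℤ.+ a i
  x≡a i = sym (ℤ.0≤i⇒+∣i∣≡i (ℤ.≤-trans (ℤ.+≤+ z≤n) (proj₁ (x-range i))))
  a-injective : Injective _≡_ _≡_ a
  a-injective {i} {j} ai≡aj = x-injective (trans (x≡a i) (trans (cong ℤ.+_ ai≡aj) (sym (x≡a j))))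
  a²≤bound : ∀ i → a i * a i ≤ bound n
  a²≤bound i = ℤ.drop‿+≤+ (subst (ℤ._≤ ℤ.+ bound n)
    (trans (cong₂ ℤ._*_ (x≡a i) (x≡a i)) (sym (ℤ.pos-* (a i) (a i)))) (proj₂ (x-range i)))
  instance
    _ : NonZero n
    _ = >-nonZero (≤-trans (≤ᵇ⇒≤ 1 40 _) 40≤n)
    _ : NonZero (n ^ 3)
    _ = m^n≢0 n 3
    _ : NonZero (gapProduct a)
    _ = >-nonZero (gapProduct>0 a)
  non-divisor : ∃[ q ] q < n ^ 3 + n ^ 3 × ¬ (suc q ∣ gapProduct a)
  non-divisor = ∃-non-divisor (n ^ 3) (≤-<-trans
    (*-monoʳ-≤ 4 (gapProduct²≤ a (bound n) (>-nonZero⁻¹ (bound n) {{bound≢0 n}}) a²≤bound))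
    (4*bound[n]^[n*n]<16^[n^3] 40≤n))
  q : ℕ
  q = proj₁ non-divisor
  separates : ∀ i j → suc q ∣ ∣ a i - a j ∣ → i ≡ j
  separates i j = a-injective ∘ ∤gapProduct⇒separates a (proj₂ (proj₂ non-divisor))
  ⌈p/2⌉≤n³ : ⌈ suc q /2⌉ ≤ n ^ 3
  ⌈p/2⌉≤n³ = subst (⌈ suc q /2⌉ ≤_) (sym (n≡⌈n+n/2⌉ (n ^ 3)))
    (⌈n/2⌉-mono (proj₁ (proj₂ non-divisor)))

lemma2 : ∃[ N ] ((n : ℕ) → n ≥ N →
           (x : Fin n → ℤ) → Distinct x → ((i : Fin n) → InRangeM n (x i)) →
           ∃[ k ] Σ (Fin k → Fin n) (λ ι → Injective _≡_ _≡_ ι × 2 * k ≥ n ×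
             ∃[ y ] (IsCompression (λ a → x (ι a)) y × ((a : Fin k) → InSegment n (y a)))))
lemma2 = 40 , λ n → half-compression-into-n³
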